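{- Let $n \ge 1$. A set $I \subseteq \mathbb{Z}_3^n$ is a maximum size independent set of $H(n,3)$ if and only if there exist $b \in \{1,2\}^n$ with $b_1 = 1$ and $c \in \mathbb{Z}_3$ such that $I = \{x \in \mathbb{Z}_3^n : \sum_{i=1}^n b_i x_i \equiv c \pmod 3\}$. Moreover, for each $I$ of this form, the only independent sets of $H(n,3)$ of size $3^{n-1}$ which are disjoint from $I$ are $I' = \{x \in \mathbb{Z}_3^n : \sum_{i=1}^n b_i x_i \equiv c+1 \pmod 3\}$ and $I'' = \{x \in \mathbb{Z}_3^n : \sum_{i=1}^n b_i x_i \equiv c+2 \pmod 3\}$.
   Context: $H(n,3)$ is the Hamming graph: its vertex set is $\mathbb{Z}_3^n$ and two vertices are adjacent if and only if they differ in exactly one coordinate. A maximum size independent set is an independent set of largest possible cardinality (this cardinality is $3^{n-1}$). -}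

module Defs where

open import Data.Nat using (ℕ; zero; suc; _+_; _*_; _^_)
open import Data.Nat.DivMod using (_%_)
open import Data.Fin using (Fin; toℕ) renaming (zero to fzero; suc to fsuc)
open import Data.Fin.Properties using () renaming (_≟_ to _≟F_)
open import Data.Vec using (Vec; []; _∷_)
open import Data.Vec.Relation.Unary.All using (All)
open import Data.List using (List; []; _∷_; _++_; map; length; filterᵇ; concatMap)
open import Data.Bool using (Bool; true; false)
open import Data.Product using (_×_)
open import Relation.Nullary using (¬_; does)
open import Relation.Binary.PropositionalEquality using (_≡_; _≢_)
import Data.Nat as N

Vertex : ℕ → Set
Vertex n = Vec (Fin 3) n

VSet : ℕ → Set
VSet n = Vertex n → Bool

allFin3 : List (Fin 3)
allFin3 = fzero ∷ fsuc fzero ∷ fsuc (fsuc fzero) ∷ []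

allVertices : (n : ℕ) → List (Vertex n)
allVertices zero = [] ∷ []
allVertices (suc n) = concatMap (λ a → map (a ∷_) (allVertices n)) allFin3

size : {n : ℕ} → VSet n → ℕ
size {n} I = length (filterᵇ I (allVertices n))

dist : {n : ℕ} → Vertex n → Vertex n → ℕ
dist [] [] = 0
dist (a ∷ x) (b ∷ y) = (if does (a ≟F b) then 0 else 1) + dist x y
  where open import Data.Bool using (if_then_else_)

Adjacent : {n : ℕ} → Vertex n → Vertex n → Set
Adjacent x y = dist x y ≡ 1

Independent : {n : ℕ} → VSet n → Set
Independent I = ∀ x y → I x ≡ true → I y ≡ true → ¬ Adjacent x y

MaxIndependent : {n : ℕ} → VSet n → Set
MaxIndependent {n} I = Independent I × ((J : VSet n) → Independent J → size J N.≤ size I)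

_≐_ : {n : ℕ} → VSet n → VSet n → Set
I ≐ J = ∀ x → I x ≡ J x

Disjoint : {n : ℕ} → VSet n → VSet n → Set
Disjoint I J = ∀ x → I x ≡ true → J x ≡ false

dot : {n : ℕ} → Vec (Fin 3) n → Vertex n → ℕ
dot [] [] = 0
dot (b ∷ bs) (x ∷ xs) = toℕ b * toℕ x + dot bs xs

plane : {n : ℕ} → Vec (Fin 3) n → ℕ → VSet n
plane b k x = does ((dot b x % 3) N.≟ (k % 3))

ValidCoeff : {m : ℕ} → Vec (Fin 3) (suc m) → Set
ValidCoeff (b₁ ∷ bs) = (b₁ ≡ fsuc fzero) × All (λ bi → bi ≢ fzero) bs

{-# OPTIONS --safe #-}
-- An independent set of H(m+1,3) meets each line {(a , t) : a ∈ ℤ₃} at most once, so it has at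
-- most 3ᵐ elements, with equality exactly when it is the graph {(f t , t)} of a map f : ℤ₃ᵐ → ℤ₃;
-- independence of the graph says that f is a proper 3-colouring of H(m,3).  By induction on m,
-- every proper 3-colouring is affine, f t = c − Σ bᵢ tᵢ with all bᵢ ≠ 0: the slices f (a , ·) are
-- affine and pairwise everywhere different, two affine maps that never agree have the same linear
-- part, and the offsets of the slices then form a permutation of ℤ₃, which is affine.  The graph
-- of f is the plane x₀ + Σ bᵢ xᵢ ≡ c, and two such planes are disjoint exactly when they are
-- parallel and distinct.
module Submission where

open import Defs
open import Data.Nat using (ℕ; suc; _+_; _^_)
open import Data.Fin using (Fin; toℕ)
open import Data.Vec using (Vec)
open import Data.Product using (_×_; ∃-syntax; Σ-syntax)
open import Data.Sum using (_⊎_)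
open import Function.Bundles using (_⇔_)
open import Relation.Binary.PropositionalEquality using (_≡_)

open import Algebra.Properties.CommutativeSemigroup using (interchange)
open import Data.Bool using (Bool; true; false)
open import Data.Fin.Patterns using (0F; 1F; 2F)
open import Data.Fin.Properties using (_≟_; all?; any?; toℕ-injective; toℕ<n)
open import Data.List using (List; []; _∷_; _++_; map; length; filterᵇ; concatMap)
open import Data.List.Membership.Propositional using (_∈_)
open import Data.List.Membership.Propositional.Properties using (∈-map⁺; ∈-++⁺ˡ; ∈-++⁺ʳ)
open import Data.List.Properties using (map-++; map-∘; map-cong)
open import Data.List.Relation.Unary.Any using (here; there)
open import Data.Nat using (zero; _*_; _≤_; z≤n; s≤s) renaming (_≟_ to _≟ℕ_)
open import Data.Nat.ListAction using (sum)
open import Data.Nat.ListAction.Properties using (sum-++)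
open import Data.Nat.DivMod using (_%_; %-distribˡ-+; m<n⇒m%n≡m)
open import Data.Nat.Properties
  using (≤-antisym; +-mono-≤; 1+n≰n; suc-injective; *-identityˡ; *-zeroʳ; *-suc; +-commutativeSemigroup)
open import Data.Product using (_,_; proj₁; proj₂)
open import Data.Sum using (inj₁; inj₂)
open import Data.Vec using ([]; _∷_; replicate; tabulate)
open import Data.Vec.Relation.Unary.All using (All; []; _∷_)
open import Data.Vec.Relation.Unary.All.Properties using (tabulate⁺)
open import Function using (_∘_)
open import Function.Bundles using (Equivalence; mk⇔)
open import Function.Construct.Composition using (_⇔-∘_)
open import Function.Definitions using (Injective)
open import Function.Consequences.Propositional using (contraInjective)
open import Relation.Binary.PropositionalEquality
  using (_≢_; _≗_; refl; sym; trans; cong; cong₂; subst; subst₂; module ≡-Reasoning)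
open import Relation.Nullary using (does; yes; no; contradiction)
open import Relation.Nullary.Decidable
  using (from-yes; dec-true; dec-false; does-⇔; ¬?; _→-dec_; _×-dec_; _⊎-dec_)

open Equivalence using (to; from)

-- Arithmetic in ℤ₃

infixl 6 _⊕_ _⊖_
infixl 7 _⊗_
infix 8 ⊖_

_⊕_ : Fin 3 → Fin 3 → Fin 3
0F ⊕ y  = y
1F ⊕ 0F = 1F
1F ⊕ 1F = 2F
1F ⊕ 2F = 0F
2F ⊕ 0F = 2F
2F ⊕ 1F = 0F
2F ⊕ 2F = 1F

⊖_ : Fin 3 → Fin 3
⊖ 0F = 0F
⊖ 1F = 2F
⊖ 2F = 1F

_⊖_ : Fin 3 → Fin 3 → Fin 3
x ⊖ y = x ⊕ ⊖ y

_⊗_ : Fin 3 → Fin 3 → Fin 3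
0F ⊗ _ = 0F
1F ⊗ y = y
2F ⊗ y = ⊖ y

⊕-identityʳ : ∀ x → x ⊕ 0F ≡ x
⊕-identityʳ = from-yes (all? λ x → x ⊕ 0F ≟ x)

⊗-zeroʳ : ∀ x → x ⊗ 0F ≡ 0F
⊗-zeroʳ = from-yes (all? λ x → x ⊗ 0F ≟ 0F)

⊕-cancelˡ : ∀ x y z → x ⊕ y ≡ x ⊕ z → y ≡ z
⊕-cancelˡ = from-yes (all? λ x → all? λ y → all? λ z → (x ⊕ y ≟ x ⊕ z) →-dec (y ≟ z))

⊕-cancelʳ : ∀ x y z → y ⊕ x ≡ z ⊕ x → y ≡ z
⊕-cancelʳ = from-yes (all? λ x → all? λ y → all? λ z → (y ⊕ x ≟ z ⊕ x) →-dec (y ≟ z))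

⊖-cancelˡ : ∀ x y z → x ⊖ y ≡ x ⊖ z → y ≡ z
⊖-cancelˡ = from-yes (all? λ x → all? λ y → all? λ z → (x ⊖ y ≟ x ⊖ z) →-dec (y ≟ z))

⊗-cancelˡ : ∀ x y z → x ≢ 0F → x ⊗ y ≡ x ⊗ z → y ≡ z
⊗-cancelˡ = from-yes (all? λ x → all? λ y → all? λ z →
  ¬? (x ≟ 0F) →-dec (x ⊗ y ≟ x ⊗ z) →-dec (y ≟ z))

⊖-⊕-assoc : ∀ x y z → x ⊖ y ⊖ z ≡ x ⊖ (y ⊕ z)
⊖-⊕-assoc = from-yes (all? λ x → all? λ y → all? λ z → x ⊖ y ⊖ z ≟ x ⊖ (y ⊕ z))

⊕≡⇔≡⊖ : ∀ x y z → x ⊕ y ≡ z ⇔ x ≡ z ⊖ y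
⊕≡⇔≡⊖ x y z = mk⇔ (⊕≡⇒≡⊖ x y z) (≡⊖⇒⊕≡ x y z)
  where
    ⊕≡⇒≡⊖ : ∀ x y z → x ⊕ y ≡ z → x ≡ z ⊖ y
    ⊕≡⇒≡⊖ = from-yes (all? λ x → all? λ y → all? λ z → (x ⊕ y ≟ z) →-dec (x ≟ z ⊖ y))
    ≡⊖⇒⊕≡ : ∀ x y z → x ≡ z ⊖ y → x ⊕ y ≡ z
    ≡⊖⇒⊕≡ = from-yes (all? λ x → all? λ y → all? λ z → (x ≟ z ⊖ y) →-dec (x ⊕ y ≟ z))

k≢0⇒x⊕k≢x : ∀ x k → k ≢ 0F → x ⊕ k ≢ x
k≢0⇒x⊕k≢x = from-yes (all? λ x → all? λ k → ¬? (k ≟ 0F) →-dec ¬? (x ⊕ k ≟ x))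

≢⇒≡⊕1⊎≡⊕2 : ∀ x y → y ≢ x → y ≡ x ⊕ 1F ⊎ y ≡ x ⊕ 2F
≢⇒≡⊕1⊎≡⊕2 = from-yes (all? λ x → all? λ y → ¬? (y ≟ x) →-dec ((y ≟ x ⊕ 1F) ⊎-dec (y ≟ x ⊕ 2F)))

toℕ-⊕ : ∀ x y → toℕ (x ⊕ y) ≡ (toℕ x + toℕ y) % 3
toℕ-⊕ = from-yes (all? λ x → all? λ y → toℕ (x ⊕ y) ≟ℕ (toℕ x + toℕ y) % 3)

toℕ-⊗ : ∀ x y → toℕ (x ⊗ y) ≡ (toℕ x * toℕ y) % 3
toℕ-⊗ = from-yes (all? λ x → all? λ y → toℕ (x ⊗ y) ≟ℕ (toℕ x * toℕ y) % 3)

distinct-slopes-meet : ∀ x y c c' w → x ≢ y → ∃[ a ] c ⊖ (x ⊗ a ⊕ w) ≡ c' ⊖ (y ⊗ a ⊕ w)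
distinct-slopes-meet = from-yes (all? λ x → all? λ y → all? λ c → all? λ c' → all? λ w →
  ¬? (x ≟ y) →-dec any? λ a → c ⊖ (x ⊗ a ⊕ w) ≟ c' ⊖ (y ⊗ a ⊕ w))

permutation-affine : ∀ u v w → u ≢ v → u ≢ w → v ≢ w →
  ∃[ e ] e ≢ 0F × u ≡ u ⊖ e ⊗ 0F × v ≡ u ⊖ e ⊗ 1F × w ≡ u ⊖ e ⊗ 2F
permutation-affine = from-yes (all? λ u → all? λ v → all? λ w →
  ¬? (u ≟ v) →-dec ¬? (u ≟ w) →-dec ¬? (v ≟ w) →-dec any? λ e →
  ¬? (e ≟ 0F) ×-dec (u ≟ u ⊖ e ⊗ 0F) ×-dec (v ≟ u ⊖ e ⊗ 1F) ×-dec (w ≟ u ⊖ e ⊗ 2F))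

injective⇒affine : (g : Fin 3 → Fin 3) → Injective _≡_ _≡_ g →
  ∃[ e ] e ≢ 0F × (∀ a → g a ≡ g 0F ⊖ e ⊗ a)
injective⇒affine g g-injective =
  let e , e≢0 , at0 , at1 , at2 =
        permutation-affine (g 0F) (g 1F) (g 2F) (apart λ ()) (apart λ ()) (apart λ ())
  in e , e≢0 , λ { 0F → at0 ; 1F → at1 ; 2F → at2 }
  where
    apart : ∀ {a a'} → a ≢ a' → g a ≢ g a'
    apart = contraInjective g-injective

-- The Hamming graph

dist-refl : ∀ {n} (x : Vertex n) → dist x x ≡ 0
dist-refl [] = refl
dist-refl (a ∷ x) rewrite dec-true (a ≟ a) refl = dist-refl x

dist≡0⇒≡ : ∀ {n} {x y : Vertex n} → dist x y ≡ 0 → x ≡ y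
dist≡0⇒≡ {x = []} {[]} _ = refl
dist≡0⇒≡ {x = a ∷ x} {b ∷ y} d≡0 with a ≟ b
... | yes refl = cong (a ∷_) (dist≡0⇒≡ d≡0)
... | no _ = contradiction d≡0 λ ()

adjacent-tail : ∀ {n} {a} {x y : Vertex n} → Adjacent x y → Adjacent (a ∷ x) (a ∷ y)
adjacent-tail {a = a} x~y rewrite dec-true (a ≟ a) refl = x~y

adjacent-head : ∀ {n} {a a'} {x : Vertex n} → a ≢ a' → Adjacent (a ∷ x) (a' ∷ x)
adjacent-head {a = a} {a'} {x} a≢a' rewrite dec-false (a ≟ a') a≢a' = cong suc (dist-refl x)

adjacent-∷⁻ : ∀ {n} {a a'} {x y : Vertex n} → Adjacent (a ∷ x) (a' ∷ y) →
  (a ≡ a' × Adjacent x y) ⊎ (a ≢ a' × x ≡ y)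
adjacent-∷⁻ {a = a} {a'} adj with a ≟ a'
... | yes a≡a' = inj₁ (a≡a' , adj)
... | no a≢a' = inj₂ (a≢a' , dist≡0⇒≡ (suc-injective adj))

Proper : ∀ {n} → (Vertex n → Fin 3) → Set
Proper f = ∀ x y → Adjacent x y → f x ≢ f y

-- Affine maps on H(n,3)

infixl 7 _·_

_·_ : ∀ {n} → Vec (Fin 3) n → Vertex n → Fin 3
[] · [] = 0F
(β ∷ b) · (a ∷ x) = β ⊗ a ⊕ b · x

affine : ∀ {n} → Vec (Fin 3) n → Fin 3 → Vertex n → Fin 3
affine b c x = c ⊖ b · x

Nonzero : ∀ {n} → Vec (Fin 3) n → Set
Nonzero = All (_≢ 0F)

origin : ∀ {n} → Vertex n
origin {n} = replicate n 0F

·-∷-0F : ∀ {n} x (b : Vec (Fin 3) n) t → (x ∷ b) · (0F ∷ t) ≡ b · t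
·-∷-0F x b t = cong (_⊕ b · t) (⊗-zeroʳ x)

·-origin : ∀ {n} (b : Vec (Fin 3) n) → b · origin ≡ 0F
·-origin [] = refl
·-origin (β ∷ b) = trans (·-∷-0F β b origin) (·-origin b)

affine-origin : ∀ {n} (b : Vec (Fin 3) n) c → affine b c origin ≡ c
affine-origin b c = trans (cong (_⊖_ c) (·-origin b)) (⊕-identityʳ c)

dot-%3 : ∀ {n} (b : Vec (Fin 3) n) x → dot b x % 3 ≡ toℕ (b · x)
dot-%3 [] [] = refl
dot-%3 (β ∷ b) (a ∷ x) = begin
  (toℕ β * toℕ a + dot b x) % 3                ≡⟨ %-distribˡ-+ (toℕ β * toℕ a) (dot b x) 3 ⟩
  ((toℕ β * toℕ a) % 3 + dot b x % 3) % 3      ≡⟨ cong₂ (λ u v → (u + v) % 3) (sym (toℕ-⊗ β a)) (dot-%3 b x) ⟩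
  (toℕ (β ⊗ a) + toℕ (b · x)) % 3              ≡⟨ sym (toℕ-⊕ (β ⊗ a) (b · x)) ⟩
  toℕ (β ⊗ a ⊕ b · x)                          ∎
  where open ≡-Reasoning

·-adjacent : ∀ {n} {b : Vec (Fin 3) n} {x y} → Nonzero b → Adjacent x y → b · x ≢ b · y
·-adjacent {b = []} {[]} {[]} [] ()
·-adjacent {b = β ∷ b} {a ∷ x} {a' ∷ y} (β≢0 ∷ b≢0) adj with adjacent-∷⁻ {a = a} {a'} {x} {y} adj
... | inj₁ (refl , x~y) = ·-adjacent b≢0 x~y ∘ ⊕-cancelˡ (β ⊗ a) (b · x) (b · y)
... | inj₂ (a≢a' , refl) = a≢a' ∘ ⊗-cancelˡ β a a' β≢0 ∘ ⊕-cancelʳ (b · x) (β ⊗ a) (β ⊗ a')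

affine-proper : ∀ {n} {b : Vec (Fin 3) n} {c} → Nonzero b → Proper (affine b c)
affine-proper {c = c} b≢0 x y x~y = ·-adjacent b≢0 x~y ∘ ⊖-cancelˡ c _ _

apart⇒same-head : ∀ {n} x y (b : Vec (Fin 3) n) c c' →
  (∀ t → affine (x ∷ b) c t ≢ affine (y ∷ b) c' t) → x ≡ y
apart⇒same-head x y b c c' apart with x ≟ y
... | yes x≡y = x≡y
... | no x≢y =
  let a , meet = distinct-slopes-meet x y c c' (b · origin) x≢y
  in contradiction meet (apart (a ∷ origin))

apart⇒tails-apart : ∀ {n} x y {b b' : Vec (Fin 3) n} {c c'} →
  (∀ t → affine (x ∷ b) c t ≢ affine (y ∷ b') c' t) → ∀ t → affine b c t ≢ affine b' c' t
apart⇒tails-apart x y {b} {b'} {c} {c'} apart t = apart (0F ∷ t) ∘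
  subst₂ _≡_ (cong (_⊖_ c) (sym (·-∷-0F x b t))) (cong (_⊖_ c') (sym (·-∷-0F y b' t)))

apart⇒same-slope : ∀ {n} {b b' : Vec (Fin 3) n} {c c'} →
  (∀ t → affine b c t ≢ affine b' c' t) → b ≡ b'
apart⇒same-slope {b = []} {[]} _ = refl
apart⇒same-slope {b = x ∷ b} {y ∷ b'} {c} {c'} apart
  with refl ← apart⇒same-slope {b = b} {b'} {c} {c'} (apart⇒tails-apart x y apart)
  = cong (_∷ b) (apart⇒same-head x y b c c' apart)

-- Counting

indicator : Bool → ℕ
indicator true = 1
indicator false = 0

length-filterᵇ : ∀ {A : Set} (p : A → Bool) xs → length (filterᵇ p xs) ≡ sum (map (indicator ∘ p) xs)
length-filterᵇ p [] = refl
length-filterᵇ p (x ∷ xs) with p x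
... | true = cong suc (length-filterᵇ p xs)
... | false = length-filterᵇ p xs

sum-map-+ : ∀ {A : Set} (f g : A → ℕ) xs → sum (map (λ x → f x + g x) xs) ≡ sum (map f xs) + sum (map g xs)
sum-map-+ f g [] = refl
sum-map-+ f g (x ∷ xs) =
  trans (cong (f x + g x +_) (sum-map-+ f g xs)) (interchange +-commutativeSemigroup (f x) (g x) _ _)

sum-map-const : ∀ {A : Set} {f : A → ℕ} {k} → (∀ x → f x ≡ k) → ∀ xs → sum (map f xs) ≡ k * length xs
sum-map-const {k = k} fx≡k [] = sym (*-zeroʳ k)
sum-map-const {k = k} fx≡k (x ∷ xs) =
  trans (cong₂ _+_ (fx≡k x) (sum-map-const fx≡k xs)) (sym (*-suc k (length xs)))

sum-concatMap : ∀ {A B C : Set} (h : C → ℕ) (g : A → B → C) xs ys →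
  sum (map h (concatMap (λ a → map (g a) ys) xs)) ≡ sum (map (λ y → sum (map (λ a → h (g a y)) xs)) ys)
sum-concatMap h g [] ys = sym (sum-map-const (λ _ → refl) ys)
sum-concatMap {A} {B} {C} h g (a ∷ xs) ys = begin
    sum (map h (map (g a) ys ++ rest))
  ≡⟨ cong sum (map-++ h (map (g a) ys) rest) ⟩
    sum (map h (map (g a) ys) ++ map h rest)
  ≡⟨ sum-++ (map h (map (g a) ys)) (map h rest) ⟩
    sum (map h (map (g a) ys)) + sum (map h rest)
  ≡⟨ cong₂ _+_ (cong sum (sym (map-∘ ys))) (sum-concatMap h g xs ys) ⟩
    sum (map (h ∘ g a) ys) + sum (map (inner xs) ys)
  ≡⟨ sym (sum-map-+ (h ∘ g a) (inner xs) ys) ⟩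
    sum (map (inner (a ∷ xs)) ys)
  ∎
  where
    open ≡-Reasoning
    rest : List C
    rest = concatMap (λ a → map (g a) ys) xs
    inner : List A → B → ℕ
    inner as y = sum (map (λ a → h (g a y)) as)

sum-map-≤-length : ∀ {A : Set} {f : A → ℕ} → (∀ x → f x ≤ 1) → ∀ xs → sum (map f xs) ≤ length xs
sum-map-≤-length f≤1 [] = z≤n
sum-map-≤-length f≤1 (x ∷ xs) = +-mono-≤ (f≤1 x) (sum-map-≤-length f≤1 xs)

+-tight : ∀ {a s l} → a ≤ 1 → s ≤ l → a + s ≡ suc l → a ≡ 1 × s ≡ l
+-tight z≤n s≤l refl = contradiction s≤l 1+n≰n
+-tight (s≤s z≤n) _ 1+s≡1+l = refl , suc-injective 1+s≡1+l

sum-map≡length⇒≡1 : ∀ {A : Set} {f : A → ℕ} → (∀ x → f x ≤ 1) →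
  ∀ {xs} → sum (map f xs) ≡ length xs → ∀ {x} → x ∈ xs → f x ≡ 1
sum-map≡length⇒≡1 f≤1 {y ∷ ys} sum≡length (here refl) =
  proj₁ (+-tight (f≤1 y) (sum-map-≤-length f≤1 ys) sum≡length)
sum-map≡length⇒≡1 f≤1 {y ∷ ys} sum≡length (there x∈ys) =
  sum-map≡length⇒≡1 f≤1 (proj₂ (+-tight (f≤1 y) (sum-map-≤-length f≤1 ys) sum≡length)) x∈ys

∈-allVertices : ∀ {n} (x : Vertex n) → x ∈ allVertices n
∈-allVertices [] = here refl
∈-allVertices {suc n} (0F ∷ t) = ∈-++⁺ˡ (∈-map⁺ (0F ∷_) (∈-allVertices t))
∈-allVertices {suc n} (1F ∷ t) =
  ∈-++⁺ʳ (map (0F ∷_) (allVertices n)) (∈-++⁺ˡ (∈-map⁺ (1F ∷_) (∈-allVertices t)))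
∈-allVertices {suc n} (2F ∷ t) =
  ∈-++⁺ʳ (map (0F ∷_) (allVertices n)) (∈-++⁺ʳ (map (1F ∷_) (allVertices n))
    (∈-++⁺ˡ (∈-map⁺ (2F ∷_) (∈-allVertices t))))

length-allVertices : ∀ m → length (allVertices m) ≡ 3 ^ m
length-allVertices zero = refl
length-allVertices (suc m) = begin
  length (allVertices (suc m))                   ≡⟨ sym (*-identityˡ _) ⟩
  1 * length (allVertices (suc m))               ≡⟨ sym (sum-map-const (λ _ → refl) (allVertices (suc m))) ⟩
  sum (map (λ _ → 1) (allVertices (suc m)))      ≡⟨ sum-concatMap (λ _ → 1) _∷_ allFin3 (allVertices m) ⟩
  sum (map (λ _ → 3) (allVertices m))            ≡⟨ sum-map-const (λ _ → refl) (allVertices m) ⟩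
  3 * length (allVertices m)                     ≡⟨ cong (3 *_) (length-allVertices m) ⟩
  3 ^ suc m                                      ∎
  where open ≡-Reasoning

-- Vertex sets and graphs of maps

≐-sym : ∀ {n} {I J : VSet n} → I ≐ J → J ≐ I
≐-sym I≐J x = sym (I≐J x)

≐-trans : ∀ {n} {I J K : VSet n} → I ≐ J → J ≐ K → I ≐ K
≐-trans I≐J J≐K x = trans (I≐J x) (J≐K x)

independent-cong : ∀ {n} {I J : VSet n} → I ≐ J → Independent J → Independent I
independent-cong I≐J J-ind x y Ix Iy = J-ind x y (trans (sym (I≐J x)) Ix) (trans (sym (I≐J y)) Iy)

size-cong : ∀ {n} {I J : VSet n} → I ≐ J → size I ≡ size J
size-cong {n} {I} {J} I≐J = begin
  size I                                       ≡⟨ length-filterᵇ I (allVertices n) ⟩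
  sum (map (indicator ∘ I) (allVertices n))    ≡⟨ cong sum (map-cong (cong indicator ∘ I≐J) (allVertices n)) ⟩
  sum (map (indicator ∘ J) (allVertices n))    ≡⟨ sym (length-filterᵇ J (allVertices n)) ⟩
  size J                                       ∎
  where open ≡-Reasoning

disjoint-cong : ∀ {n} {I I' J J' : VSet n} → I ≐ I' → J ≐ J' → Disjoint I J → Disjoint I' J'
disjoint-cong I≐I' J≐J' I∩J=∅ x I'x = trans (sym (J≐J' x)) (I∩J=∅ x (trans (I≐I' x) I'x))

column : ∀ {m} → VSet (suc m) → Vertex m → ℕ
column J t = sum (map (λ a → indicator (J (a ∷ t))) allFin3)

size-by-columns : ∀ {m} (J : VSet (suc m)) → size J ≡ sum (map (column J) (allVertices m))
size-by-columns {m} J =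
  trans (length-filterᵇ J (allVertices (suc m))) (sum-concatMap (indicator ∘ J) _∷_ allFin3 (allVertices m))

column-unique : ∀ {m} {J : VSet (suc m)} → Independent J →
  ∀ {a a' t} → J (a ∷ t) ≡ true → J (a' ∷ t) ≡ true → a ≡ a'
column-unique J-ind {a} {a'} {t} Ja Ja' with a ≟ a'
... | yes a≡a' = a≡a'
... | no a≢a' = contradiction (adjacent-head {x = t} a≢a') (J-ind _ _ Ja Ja')

column-≤1 : ∀ {m} {J : VSet (suc m)} → Independent J → ∀ t → column J t ≤ 1
column-≤1 {J = J} J-ind t with J (0F ∷ t) in J0 | J (1F ∷ t) in J1 | J (2F ∷ t) in J2
... | false | false | false = z≤n
... | true  | false | false = s≤s z≤n
... | false | true  | false = s≤s z≤n
... | false | false | true  = s≤s z≤n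
... | true  | true  | _     = contradiction (column-unique {J = J} J-ind J0 J1) λ ()
... | true  | false | true  = contradiction (column-unique {J = J} J-ind J0 J2) λ ()
... | false | true  | true  = contradiction (column-unique {J = J} J-ind J1 J2) λ ()

column≡1⇒inhabited : ∀ {m} {J : VSet (suc m)} {t} → column J t ≡ 1 → ∃[ a ] J (a ∷ t) ≡ true
column≡1⇒inhabited {J = J} {t} column≡1 with J (0F ∷ t) in J0 | J (1F ∷ t) in J1 | J (2F ∷ t) in J2
... | true  | _     | _     = 0F , J0
... | false | true  | _     = 1F , J1
... | false | false | true  = 2F , J2
... | false | false | false = contradiction column≡1 λ ()

independent⇒size≤ : ∀ {m} {J : VSet (suc m)} → Independent J → size J ≤ 3 ^ m
independent⇒size≤ {m} {J} J-ind = subst₂ _≤_ (sym (size-by-columns J)) (length-allVertices m)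
  (sum-map-≤-length (column-≤1 J-ind) (allVertices m))

graph : ∀ {m} → (Vertex m → Fin 3) → VSet (suc m)
graph f (a ∷ t) = does (a ≟ f t)

graph⁻ : ∀ {m} (f : Vertex m → Fin 3) a t → graph f (a ∷ t) ≡ true → a ≡ f t
graph⁻ f a t a∈graph with a ≟ f t
... | yes a≡ft = a≡ft

graph-cong : ∀ {m} {f g : Vertex m → Fin 3} → f ≗ g → graph f ≐ graph g
graph-cong f≗g (a ∷ t) = cong (does ∘ (a ≟_)) (f≗g t)

graph-column : ∀ {m} (f : Vertex m → Fin 3) t → column (graph f) t ≡ 1
graph-column f t with f t
... | 0F = refl
... | 1F = refl
... | 2F = refl

graph-size : ∀ {m} (f : Vertex m → Fin 3) → size (graph f) ≡ 3 ^ m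
graph-size {m} f = begin
  size (graph f)                                   ≡⟨ size-by-columns (graph f) ⟩
  sum (map (column (graph f)) (allVertices m))     ≡⟨ sum-map-const (graph-column f) (allVertices m) ⟩
  1 * length (allVertices m)                       ≡⟨ *-identityˡ _ ⟩
  length (allVertices m)                           ≡⟨ length-allVertices m ⟩
  3 ^ m                                            ∎
  where open ≡-Reasoning

graph-independent : ∀ {m} {f : Vertex m → Fin 3} → Proper f → Independent (graph f)
graph-independent {f = f} f-proper (a ∷ x) (a' ∷ y) a∈ a'∈ adj with adjacent-∷⁻ {a = a} {a'} {x} {y} adj
... | inj₁ (refl , x~y) = f-proper x y x~y (trans (sym (graph⁻ f a x a∈)) (graph⁻ f a' y a'∈))
... | inj₂ (a≢a' , refl) = a≢a' (trans (graph⁻ f a x a∈) (sym (graph⁻ f a' y a'∈)))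

disjoint-graphs⇔apart : ∀ {m} {f g : Vertex m → Fin 3} → Disjoint (graph f) (graph g) ⇔ (∀ t → f t ≢ g t)
disjoint-graphs⇔apart {f = f} {g} = mk⇔
  (λ disjoint t ft≡gt → contradiction
    (trans (sym (disjoint (f t ∷ t) (dec-true (f t ≟ f t) refl))) (dec-true (f t ≟ g t) ft≡gt)) λ ())
  (λ { apart (a ∷ t) a∈f → dec-false (a ≟ g t) (apart t ∘ trans (sym (graph⁻ f a t a∈f))) })

full-independent⇒graph : ∀ {m} {J : VSet (suc m)} → Independent J → size J ≡ 3 ^ m →
  ∃[ f ] Proper f × J ≐ graph f
full-independent⇒graph {m} {J} J-ind J-size = f , f-proper , J≐graph
  where
    full-column : ∀ t → column J t ≡ 1
    full-column t = sum-map≡length⇒≡1 (column-≤1 J-ind)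
      (trans (sym (size-by-columns J)) (trans J-size (sym (length-allVertices m)))) (∈-allVertices t)
    choice : ∀ t → ∃[ a ] J (a ∷ t) ≡ true
    choice t = column≡1⇒inhabited {J = J} (full-column t)
    f : Vertex m → Fin 3
    f t = proj₁ (choice t)
    f∈J : ∀ t → J (f t ∷ t) ≡ true
    f∈J t = proj₂ (choice t)
    f-proper : Proper f
    f-proper x y x~y fx≡fy = J-ind _ _ (f∈J x)
      (subst (λ a → J (a ∷ y) ≡ true) (sym fx≡fy) (f∈J y)) (adjacent-tail {a = f x} {x} {y} x~y)
    J≐graph : J ≐ graph f
    J≐graph (a ∷ t) with J (a ∷ t) in Ja
    ... | true = sym (dec-true (a ≟ f t) (column-unique {J = J} J-ind Ja (f∈J t)))
    ... | false = sym (dec-false (a ≟ f t) λ a≡ft →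
      contradiction (trans (sym Ja) (subst (λ b → J (b ∷ t) ≡ true) (sym a≡ft) (f∈J t))) λ ())

-- Proper 3-colourings

record AffineColouring {m} (f : Vertex m → Fin 3) : Set where
  field
    slope         : Vec (Fin 3) m
    offset        : Fin 3
    slope-nonzero : Nonzero slope
    f≗affine      : f ≗ affine slope offset

  offset≡f-origin : offset ≡ f origin
  offset≡f-origin = sym (trans (f≗affine origin) (affine-origin slope offset))

proper⇒affine : ∀ {m} {f : Vertex m → Fin 3} → Proper f → AffineColouring f
proper⇒affine {zero} {f} _ = record
  { slope = [] ; offset = f [] ; slope-nonzero = [] ; f≗affine = λ { [] → sym (⊕-identityʳ (f [])) } }
proper⇒affine {suc m} {f} f-proper = record
  { slope         = e ∷ slope 0F
  ; offset        = offset 0F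
  ; slope-nonzero = e≢0 ∷ slope-nonzero 0F
  ; f≗affine      = f≗affine′
  }
  where
    slice : Fin 3 → Vertex m → Fin 3
    slice a t = f (a ∷ t)

    slices-apart : ∀ {a a'} → a ≢ a' → ∀ t → slice a t ≢ slice a' t
    slices-apart a≢a' t = f-proper _ _ (adjacent-head {x = t} a≢a')

    module Slice (a : Fin 3) = AffineColouring
      (proper⇒affine {f = slice a} λ x y x~y → f-proper _ _ (adjacent-tail {a = a} {x} {y} x~y))
    open Slice

    same-slope : ∀ a → slope a ≡ slope 0F
    same-slope a with a ≟ 0F
    ... | yes refl = refl
    ... | no a≢0 = apart⇒same-slope {c = offset a} {offset 0F} λ t eq →
      slices-apart a≢0 t (trans (f≗affine a t) (trans eq (sym (f≗affine 0F t))))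

    offset-injective : Injective _≡_ _≡_ offset
    offset-injective {a} {a'} eq with a ≟ a'
    ... | yes a≡a' = a≡a'
    ... | no a≢a' = contradiction
      (trans (sym (offset≡f-origin a)) (trans eq (offset≡f-origin a'))) (slices-apart a≢a' origin)

    linear-part : ∃[ e ] e ≢ 0F × (∀ a → offset a ≡ offset 0F ⊖ e ⊗ a)
    linear-part = injective⇒affine offset offset-injective

    e : Fin 3
    e = proj₁ linear-part

    e≢0 : e ≢ 0F
    e≢0 = proj₁ (proj₂ linear-part)

    f≗affine′ : f ≗ affine (e ∷ slope 0F) (offset 0F)
    f≗affine′ (a ∷ t) = begin
        f (a ∷ t)
      ≡⟨ f≗affine a t ⟩
        offset a ⊖ slope a · t
      ≡⟨ cong₂ (λ c b → c ⊖ b · t) (proj₂ (proj₂ linear-part) a) (same-slope a) ⟩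
        offset 0F ⊖ e ⊗ a ⊖ slope 0F · t
      ≡⟨ ⊖-⊕-assoc (offset 0F) (e ⊗ a) (slope 0F · t) ⟩
        offset 0F ⊖ (e ⊗ a ⊕ slope 0F · t)
      ∎
      where open ≡-Reasoning

-- Independent sets of size 3ᵐ

full-independent⇔affine-graph : ∀ {m} {J : VSet (suc m)} →
  (Independent J × size J ≡ 3 ^ m)
  ⇔ (Σ[ b ∈ Vec (Fin 3) m ] Σ[ c ∈ Fin 3 ] (Nonzero b × J ≐ graph (affine b c)))
full-independent⇔affine-graph {J = J} = mk⇔
  (λ (J-ind , J-size) →
    let f , f-proper , J≐graph = full-independent⇒graph {J = J} J-ind J-size
        open AffineColouring (proper⇒affine f-proper)
    in slope , offset , slope-nonzero , ≐-trans J≐graph (graph-cong f≗affine))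
  (λ (b , c , b≢0 , J≐graph) →
    independent-cong J≐graph (graph-independent (affine-proper b≢0)) ,
    trans (size-cong J≐graph) (graph-size (affine b c)))

maxIndependent⇔full : ∀ {m} {I : VSet (suc m)} → MaxIndependent I ⇔ (Independent I × size I ≡ 3 ^ m)
maxIndependent⇔full {m} {I} = mk⇔
  (λ (I-ind , I-max) → I-ind , ≤-antisym (independent⇒size≤ I-ind)
    (subst (_≤ size I) (graph-size (affine ones 0F)) (I-max _ (graph-independent (affine-proper ones≢0)))))
  (λ (I-ind , I-size) → I-ind , λ J J-ind → subst (size J ≤_) (sym I-size) (independent⇒size≤ J-ind))
  where
    ones : Vec (Fin 3) m
    ones = tabulate λ _ → 1F
    ones≢0 : Nonzero ones
    ones≢0 = tabulate⁺ λ _ ()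

toℕ-%3 : ∀ (c : Fin 3) → toℕ c % 3 ≡ toℕ c
toℕ-%3 c = m<n⇒m%n≡m (toℕ<n c)

plane≐graph : ∀ {m} (b : Vec (Fin 3) m) k {c} → k % 3 ≡ toℕ c → plane (1F ∷ b) k ≐ graph (affine b c)
plane≐graph b k {c} k≡c (a ∷ t) = begin
    does (dot (1F ∷ b) (a ∷ t) % 3 ≟ℕ k % 3)
  ≡⟨ cong₂ (λ u v → does (u ≟ℕ v)) (dot-%3 (1F ∷ b) (a ∷ t)) k≡c ⟩
    does (toℕ (a ⊕ w) ≟ℕ toℕ c)
  ≡⟨ does-⇔ (mk⇔ toℕ-injective (cong toℕ)) (toℕ (a ⊕ w) ≟ℕ toℕ c) (a ⊕ w ≟ c) ⟩
    does (a ⊕ w ≟ c)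
  ≡⟨ does-⇔ (⊕≡⇔≡⊖ a w c) (a ⊕ w ≟ c) (a ≟ c ⊖ w) ⟩
    does (a ≟ c ⊖ w)
  ∎
  where
    open ≡-Reasoning
    w : Fin 3
    w = b · t

affine-graph⇔plane : ∀ {m} {I : VSet (suc m)} →
  (Σ[ b ∈ Vec (Fin 3) m ] Σ[ c ∈ Fin 3 ] (Nonzero b × I ≐ graph (affine b c)))
  ⇔ (Σ[ b ∈ Vec (Fin 3) (suc m) ] Σ[ c ∈ Fin 3 ] (ValidCoeff b × (I ≐ plane b (toℕ c))))
affine-graph⇔plane = mk⇔
  (λ (b , c , b≢0 , I≐graph) →
    1F ∷ b , c , (refl , b≢0) , ≐-trans I≐graph (≐-sym (plane≐graph b (toℕ c) (toℕ-%3 c))))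
  (λ { (_ ∷ b , c , (refl , b≢0) , I≐plane) →
    b , c , b≢0 , ≐-trans I≐plane (plane≐graph b (toℕ c) (toℕ-%3 c)) })

disjoint-affine-graphs⇔parallel : ∀ {m} {b b' : Vec (Fin 3) m} {c c'} →
  Disjoint (graph (affine b c)) (graph (affine b' c')) ⇔ (b ≡ b' × c ≢ c')
disjoint-affine-graphs⇔parallel {b = b} {b'} {c} {c'} = mk⇔
  (λ graphs-disjoint → let apart = to disjoint-graphs⇔apart graphs-disjoint in
    apart⇒same-slope {c = c} {c'} apart ,
    λ c≡c' → apart origin (trans (affine-origin b c) (trans c≡c' (sym (affine-origin b' c')))))
  (λ { (refl , c≢c') → from disjoint-graphs⇔apart λ t → c≢c' ∘ ⊕-cancelʳ (⊖ (b · t)) c c' })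

disjoint-full-independent⇔next-plane : ∀ {m} {b : Vec (Fin 3) m} → Nonzero b → ∀ c (J : VSet (suc m)) →
  (Independent J × size J ≡ 3 ^ m × Disjoint (plane (1F ∷ b) (toℕ c)) J)
  ⇔ ((J ≐ plane (1F ∷ b) (toℕ c + 1)) ⊎ (J ≐ plane (1F ∷ b) (toℕ c + 2)))
disjoint-full-independent⇔next-plane {m} {b} b≢0 c J = mk⇔ disjoint⇒next-plane next-plane⇒disjoint
  where
    P₀ : plane (1F ∷ b) (toℕ c) ≐ graph (affine b c)
    P₀ = plane≐graph b (toℕ c) (toℕ-%3 c)
    P₁ : plane (1F ∷ b) (toℕ c + 1) ≐ graph (affine b (c ⊕ 1F))
    P₁ = plane≐graph b (toℕ c + 1) (sym (toℕ-⊕ c 1F))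
    P₂ : plane (1F ∷ b) (toℕ c + 2) ≐ graph (affine b (c ⊕ 2F))
    P₂ = plane≐graph b (toℕ c + 2) (sym (toℕ-⊕ c 2F))

    disjoint⇒next-plane : Independent J × size J ≡ 3 ^ m × Disjoint (plane (1F ∷ b) (toℕ c)) J →
      (J ≐ plane (1F ∷ b) (toℕ c + 1)) ⊎ (J ≐ plane (1F ∷ b) (toℕ c + 2))
    disjoint⇒next-plane (J-ind , J-size , P₀∩J=∅) with to full-independent⇔affine-graph (J-ind , J-size)
    ... | b' , c' , _ , J≐graph
      with to (disjoint-affine-graphs⇔parallel {b = b} {b'} {c} {c'}) (disjoint-cong P₀ J≐graph P₀∩J=∅)
    ... | refl , c≢c' with ≢⇒≡⊕1⊎≡⊕2 c c' (c≢c' ∘ sym)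
    ... | inj₁ refl = inj₁ (≐-trans J≐graph (≐-sym P₁))
    ... | inj₂ refl = inj₂ (≐-trans J≐graph (≐-sym P₂))

    parallel-graph⇒disjoint : ∀ {c'} → c ≢ c' → J ≐ graph (affine b c') →
      Independent J × size J ≡ 3 ^ m × Disjoint (plane (1F ∷ b) (toℕ c)) J
    parallel-graph⇒disjoint {c'} c≢c' J≐graph =
      let J-ind , J-size = from full-independent⇔affine-graph (b , c' , b≢0 , J≐graph)
      in J-ind , J-size , disjoint-cong (≐-sym P₀) (≐-sym J≐graph)
           (from (disjoint-affine-graphs⇔parallel {b = b} {b} {c} {c'}) (refl , c≢c'))

    next-plane⇒disjoint : (J ≐ plane (1F ∷ b) (toℕ c + 1)) ⊎ (J ≐ plane (1F ∷ b) (toℕ c + 2)) →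
      Independent J × size J ≡ 3 ^ m × Disjoint (plane (1F ∷ b) (toℕ c)) J
    next-plane⇒disjoint (inj₁ J≐P₁) = parallel-graph⇒disjoint (k≢0⇒x⊕k≢x c 1F (λ ()) ∘ sym) (≐-trans J≐P₁ P₁)
    next-plane⇒disjoint (inj₂ J≐P₂) = parallel-graph⇒disjoint (k≢0⇒x⊕k≢x c 2F (λ ()) ∘ sym) (≐-trans J≐P₂ P₂)

proposition2p10 : (m : ℕ) →
    ((I : VSet (suc m)) →
      MaxIndependent I ⇔ (Σ[ b ∈ Vec (Fin 3) (suc m) ] Σ[ c ∈ Fin 3 ] (ValidCoeff b × (I ≐ plane b (toℕ c)))))
    × ((b : Vec (Fin 3) (suc m)) → (c : Fin 3) → ValidCoeff b → (J : VSet (suc m)) →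
      ((Independent J × size J ≡ 3 ^ m × Disjoint (plane b (toℕ c)) J)
        ⇔ ((J ≐ plane b (toℕ c + 1)) ⊎ (J ≐ plane b (toℕ c + 2)))))
proposition2p10 m =
  (λ I → affine-graph⇔plane ⇔-∘ (full-independent⇔affine-graph ⇔-∘ maxIndependent⇔full)) ,
  λ { (_ ∷ b) c (refl , b≢0) J → disjoint-full-independent⇔next-plane b≢0 c J }
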